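{- There is a number $c\in\mathbb{N}_{\geq1}$ and a sequence $(\mathrm{iso}_h(x,y))_{h\geq1}$ of first-order formulae over $\{E,L\}$ of size $\leq c\cdot h$ such that for each $h\geq 1$: if $\mathcal{F}\in\mathfrak{F}_{2,2^h}$ and $a,b$ are the roots of connected components $\mathcal{C},\mathcal{C}'$ of $\mathcal{F}$, then $\mathcal{F}\models\mathrm{iso}_h[a,b]$ if and only if $\mathcal{C}\cong\mathcal{C}'$.
   Context: $E$ is a binary and $L$ a unary relation symbol. A labeled chain of height $h$ is a finite $\{E,L\}$-structure whose $E$-relation is a directed path $v_0\to v_1\to\dots\to v_h$ (a tree in which every vertex has at most one child, with longest root-to-leaf path of length $h$) and $L$ is an arbitrary subset of its vertices (the labeled vertices); its root is the vertex of indegree $0$. $\mathfrak{F}_{2,h}$ is the class of all finite $\{E,L\}$-structures whose connected components (in the Gaifman graph) are labeled chains of height $h$. The size of a formula is its length as a word. -}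

module Defs where

open import Data.Nat using (ℕ; zero; suc; _+_; _≡ᵇ_)
open import Data.Fin using (Fin; toℕ)
open import Data.Bool using (Bool; true; false; not; _∧_; _∨_; if_then_else_)
open import Data.List using (allFin)
open import Data.Bool.ListAction using (any; all)
open import Data.Product using (Σ; _×_; proj₁; proj₂)
open import Data.Sum using (_⊎_)
open import Relation.Binary.PropositionalEquality using (_≡_; _≢_)
open import Function.Bundles using (_⇔_)

data Fm : Set where
  _≐_  : ℕ → ℕ → Fm
  Eₐ   : ℕ → ℕ → Fm
  Lₐ   : ℕ → Fm
  ¬ᶠ_  : Fm → Fm
  _∧ᶠ_ : Fm → Fm → Fm
  _∨ᶠ_ : Fm → Fm → Fm
  ∃ᶠ   : ℕ → Fm → Fm
  ∀ᶠ   : ℕ → Fm → Fm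

-- Size = length as a word, written in the usual syntax
--   x=y , Exy , Lx , ¬φ , (φ∧ψ) , (φ∨ψ) , ∃xφ , ∀xφ
-- where each variable is a single symbol.
size : Fm → ℕ
size (x ≐ y)   = 3
size (Eₐ x y)  = 3
size (Lₐ x)    = 2
size (¬ᶠ φ)    = 1 + size φ
size (φ ∧ᶠ ψ)  = 3 + size φ + size ψ
size (φ ∨ᶠ ψ)  = 3 + size φ + size ψ
size (∃ᶠ x φ)  = 2 + size φ
size (∀ᶠ x φ)  = 2 + size φ

data Free (z : ℕ) : Fm → Set where
  eqˡ : ∀ {y} → Free z (z ≐ y)
  eqʳ : ∀ {x} → Free z (x ≐ z)
  Eˡ  : ∀ {y} → Free z (Eₐ z y)
  Eʳ  : ∀ {x} → Free z (Eₐ x z)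
  L₀  : Free z (Lₐ z)
  neg : ∀ {φ} → Free z φ → Free z (¬ᶠ φ)
  ∧ˡ  : ∀ {φ ψ} → Free z φ → Free z (φ ∧ᶠ ψ)
  ∧ʳ  : ∀ {φ ψ} → Free z ψ → Free z (φ ∧ᶠ ψ)
  ∨ˡ  : ∀ {φ ψ} → Free z φ → Free z (φ ∨ᶠ ψ)
  ∨ʳ  : ∀ {φ ψ} → Free z ψ → Free z (φ ∨ᶠ ψ)
  ex  : ∀ {x φ} → z ≢ x → Free z φ → Free z (∃ᶠ x φ)
  fa  : ∀ {x φ} → z ≢ x → Free z φ → Free z (∀ᶠ x φ)

-- φ(x,y): the free variables of φ are among x := 0 and y := 1
FreeIn01 : Fm → Set
FreeIn01 φ = ∀ z → Free z φ → (z ≡ 0) ⊎ (z ≡ 1)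

record Str : Set where
  field
    n : ℕ
    E : Fin n → Fin n → Bool
    L : Fin n → Bool
open Str public

_[_↦_] : ∀ {A : Set} → (ℕ → A) → ℕ → A → (ℕ → A)
(ρ [ x ↦ a ]) z = if z ≡ᵇ x then a else ρ z

_==_ : ∀ {k} → Fin k → Fin k → Bool
i == j = toℕ i ≡ᵇ toℕ j

eval : (𝔄 : Str) → Fm → (ℕ → Fin (n 𝔄)) → Bool
eval 𝔄 (x ≐ y)  ρ = ρ x == ρ y
eval 𝔄 (Eₐ x y) ρ = E 𝔄 (ρ x) (ρ y)
eval 𝔄 (Lₐ x)   ρ = L 𝔄 (ρ x)
eval 𝔄 (¬ᶠ φ)   ρ = not (eval 𝔄 φ ρ)
eval 𝔄 (φ ∧ᶠ ψ) ρ = eval 𝔄 φ ρ ∧ eval 𝔄 ψ ρ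
eval 𝔄 (φ ∨ᶠ ψ) ρ = eval 𝔄 φ ρ ∨ eval 𝔄 ψ ρ
eval 𝔄 (∃ᶠ x φ) ρ = any (λ a → eval 𝔄 φ (ρ [ x ↦ a ])) (allFin (n 𝔄))
eval 𝔄 (∀ᶠ x φ) ρ = all (λ a → eval 𝔄 φ (ρ [ x ↦ a ])) (allFin (n 𝔄))

_⊨_[_,_] : (𝔄 : Str) → Fm → Fin (n 𝔄) → Fin (n 𝔄) → Set
𝔄 ⊨ φ [ a , b ] = eval 𝔄 φ (λ z → if z ≡ᵇ 0 then a else b) ≡ true

data Conn (𝔄 : Str) (u : Fin (n 𝔄)) : Fin (n 𝔄) → Set where
  here  : Conn 𝔄 u u
  fwd   : ∀ {v w} → Conn 𝔄 u v → E 𝔄 v w ≡ true → Conn 𝔄 u w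
  bwd   : ∀ {v w} → Conn 𝔄 u v → E 𝔄 w v ≡ true → Conn 𝔄 u w

Comp : (𝔄 : Str) → Fin (n 𝔄) → Set
Comp 𝔄 u = Σ (Fin (n 𝔄)) (Conn 𝔄 u)

CompIsChain : (𝔄 : Str) → ℕ → Fin (n 𝔄) → Set
CompIsChain 𝔄 h u =
  Σ (Fin (suc h) → Fin (n 𝔄)) λ f →
    (∀ i j → f i ≡ f j → i ≡ j) ×
    (∀ i → Conn 𝔄 u (f i)) ×
    (∀ v → Conn 𝔄 u v → Σ (Fin (suc h)) λ i → f i ≡ v) ×
    (∀ i j → E 𝔄 (f i) (f j) ≡ true ⇔ toℕ j ≡ suc (toℕ i))

In𝔉₂ : ℕ → Str → Set
In𝔉₂ h 𝔄 = ∀ u → CompIsChain 𝔄 h u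

IsRoot : (𝔄 : Str) → Fin (n 𝔄) → Set
IsRoot 𝔄 r = ∀ u → E 𝔄 u r ≡ false

CompIso : (𝔄 : Str) → Fin (n 𝔄) → Fin (n 𝔄) → Set
CompIso 𝔄 a b =
  Σ (Comp 𝔄 a → Comp 𝔄 b) λ f →
  Σ (Comp 𝔄 b → Comp 𝔄 a) λ g →
    (∀ u → proj₁ (g (f u)) ≡ proj₁ u) ×
    (∀ v → proj₁ (f (g v)) ≡ proj₁ v) ×
    (∀ u v → E 𝔄 (proj₁ u) (proj₁ v) ≡ E 𝔄 (proj₁ (f u)) (proj₁ (f v))) ×
    (∀ u → L 𝔄 (proj₁ u) ≡ L 𝔄 (proj₁ (f u)))

{-# OPTIONS --safe #-}
module Submission where

-- Write x ⇝ℓ u for "there is an E-walk of length ℓ from x to u". In a labeled chain the walk of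
-- length ℓ from the root is unique and ends at the vertex of height ℓ, so two chains of height H
-- with roots a and b are isomorphic iff L u ↔ L v whenever a ⇝ℓ u and b ⇝ℓ v for one ℓ ≤ H.
-- For H = 2^h this relation is first-order definable with O(h) symbols: a pair of walks of common
-- length ≤ 2^(k+1) splits at a pair of midpoints (z, z′) into two pairs of walks of common length
-- ≤ 2^k, and both halves are checked by ONE occurrence of the level-k formula, universally
-- quantified over the four endpoints y⃗ with the hypothesis "y⃗ is the first or the second half".

open import Defs
open import Data.Nat using (ℕ; zero; suc; _+_; _*_; _^_; _∸_; _⊓_; _≡ᵇ_; _≤_; _<_; z≤n; s≤s; NonZero)
open import Data.Nat.Properties using (≡ᵇ⇒≡; ≡⇒≡ᵇ; ≤-refl; ≤-trans; ≤-reflexive; <-trans; n<1+n; +-comm; +-identityʳ; +-mono-≤; +-monoˡ-≤; m≤m+n; m≤m*n; *-comm; *-distribʳ-+; m⊓n≤m; m⊓n+n∸m≡n; m+n∸m≡n; ∸-monoˡ-≤; module ≤-Reasoning)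
open import Data.Fin using (Fin; toℕ; zero; suc; inject₁; fromℕ<)
open import Data.Fin.Properties using (toℕ-injective; toℕ-inject₁; toℕ-fromℕ<; fromℕ<-toℕ; toℕ<n; toℕ≤pred[n])
open import Data.Bool using (Bool; true; false; not; _∧_; _∨_; T; if_then_else_)
open import Data.Bool.Properties using (T-≡; T-∧; T-∨; ⇔→≡)
open import Data.Bool.ListAction using (any; all)
open import Data.List using (allFin)
open import Data.List.Relation.Unary.Any.Properties as Any using (any⁺; any⁻)
open import Data.List.Relation.Unary.All.Properties as All using (all⁺; all⁻)
open import Data.Product using (Σ; ∃; ∃₂; _×_; _,_; proj₁; proj₂)
open import Data.Product.Function.NonDependent.Propositional using (_×-⇔_)
open import Data.Sum using (_⊎_; inj₁; inj₂)
open import Data.Sum.Function.Propositional using (_⊎-⇔_)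
open import Data.Empty using (⊥-elim)
open import Function using (_∘_)
open import Function.Bundles using (_⇔_; mk⇔; Equivalence)
open import Function.Construct.Identity using (⇔-id)
open import Function.Construct.Symmetry using (⇔-sym)
open import Function.Properties.Equivalence using () renaming (trans to ⇔-trans)
open import Function.Related.TypeIsomorphisms using (¬-cong-⇔)
open import Relation.Nullary using (¬_; Dec; yes; no; contradiction)
open import Relation.Nullary.Decidable using (T?) renaming (map to Dec-map)
open import Relation.Binary.PropositionalEquality using (_≡_; refl; sym; trans; cong; cong₂; subst; module ≡-Reasoning)

open Equivalence using (to; from)

T-not : ∀ {b} → T (not b) ⇔ (¬ T b)
T-not {true}  = mk⇔ (λ ()) (λ ¬t → ¬t _)
T-not {false} = mk⇔ (λ _ ()) _

T-== : ∀ {k} {i j : Fin k} → T (i == j) ⇔ i ≡ j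
T-== {i = i} {j} = mk⇔ (toℕ-injective ∘ ≡ᵇ⇒≡ (toℕ i) (toℕ j)) (≡⇒≡ᵇ (toℕ i) (toℕ j) ∘ cong toℕ)

T-any-allFin : ∀ {k} (p : Fin k → Bool) → T (any p (allFin k)) ⇔ ∃ (T ∘ p)
T-any-allFin p = mk⇔ (Any.tabulate⁻ ∘ any⁻ p _) (any⁺ p ∘ λ (i , t) → Any.tabulate⁺ i t)

T-all-allFin : ∀ {k} (p : Fin k → Bool) → T (all p (allFin k)) ⇔ (∀ i → T (p i))
T-all-allFin p = mk⇔ (All.tabulate⁻ ∘ all⁺ p _) (all⁻ p ∘ All.tabulate⁺)

modus-ponens : ∀ {A B : Set} → ¬ A ⊎ B → A → B
modus-ponens (inj₁ ¬a) a = contradiction a ¬a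
modus-ponens (inj₂ b)  _ = b

¬⊎-intro : ∀ {A B : Set} → Dec A → (A → B) → ¬ A ⊎ B
¬⊎-intro (yes a) f = inj₂ (f a)
¬⊎-intro (no ¬a) _ = inj₁ ¬a

∃₂-cong-⇔ : ∀ {A : Set} {P Q : A → A → Set} → (∀ x y → P x y ⇔ Q x y) → (∃₂ P) ⇔ (∃₂ Q)
∃₂-cong-⇔ P⇔Q = mk⇔ (λ (x , y , p) → x , y , to (P⇔Q x y) p) (λ (x , y , q) → x , y , from (P⇔Q x y) q)

affine≤linear : ∀ a b h .{{_ : NonZero h}} → a + h * b ≤ (a + b) * h
affine≤linear a b h = begin
  a + h * b      ≤⟨ +-monoˡ-≤ (h * b) (m≤m*n a h) ⟩
  a * h + h * b  ≡⟨ cong (a * h +_) (*-comm h b) ⟩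
  a * h + b * h  ≡⟨ *-distribʳ-+ h a b ⟨
  (a + b) * h    ∎
  where open ≤-Reasoning

split-≤-double : ∀ {H ℓ} → ℓ ≤ 2 * H → ∃₂ λ ℓ₁ ℓ₂ → ℓ ≡ ℓ₂ + ℓ₁ × ℓ₁ ≤ H × ℓ₂ ≤ H
split-≤-double {H} {ℓ} ℓ≤2H =
  H ⊓ ℓ , ℓ ∸ H , sym (trans (+-comm (ℓ ∸ H) (H ⊓ ℓ)) (m⊓n+n∸m≡n H ℓ)) , m⊓n≤m H ℓ ,
  ≤-trans (∸-monoˡ-≤ H ℓ≤2H) (≤-reflexive (trans (m+n∸m≡n H (H + 0)) (+-identityʳ H)))

infixr 2 _⇒ᶠ_ _⇔ᶠ_
infixl 8 _[x⃗≔y⃗]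

_⇒ᶠ_ : Fm → Fm → Fm
φ ⇒ᶠ ψ = (¬ᶠ φ) ∨ᶠ ψ

_⇔ᶠ_ : Fm → Fm → Fm
φ ⇔ᶠ ψ = (φ ⇒ᶠ ψ) ∧ᶠ (ψ ⇒ᶠ φ)

Vars⁴ : Set
Vars⁴ = ℕ × ℕ × ℕ × ℕ

∀⁴ : Vars⁴ → Fm → Fm
∀⁴ (a , b , c , d) φ = ∀ᶠ a (∀ᶠ b (∀ᶠ c (∀ᶠ d φ)))

_≐⁴_ : Vars⁴ → Vars⁴ → Fm
(a , b , c , d) ≐⁴ (a′ , b′ , c′ , d′) = (a ≐ a′) ∧ᶠ ((b ≐ b′) ∧ᶠ ((c ≐ c′) ∧ᶠ (d ≐ d′)))

x⃗ y⃗ : Vars⁴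
x⃗ = 0 , 1 , 2 , 3
y⃗ = 6 , 7 , 8 , 9

_[x⃗≔y⃗] : Fm → Fm
φ [x⃗≔y⃗] = ∀⁴ x⃗ ((x⃗ ≐⁴ y⃗) ⇒ᶠ φ)

halvesᶠ : Fm
halvesᶠ = (y⃗ ≐⁴ (0 , 1 , 4 , 5)) ∨ᶠ (y⃗ ≐⁴ (4 , 5 , 2 , 3))

-- Variables 0, 1 are the start points and 2, 3 the end points; 4, 5 hold the midpoints.
parallelWalkᶠ : ℕ → Fm
parallelWalkᶠ zero    = ((0 ≐ 2) ∧ᶠ (1 ≐ 3)) ∨ᶠ (Eₐ 0 2 ∧ᶠ Eₐ 1 3)
parallelWalkᶠ (suc k) = ∃ᶠ 4 (∃ᶠ 5 (∀⁴ y⃗ (halvesᶠ ⇒ᶠ parallelWalkᶠ k [x⃗≔y⃗])))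

isoᶠ : ℕ → Fm
isoᶠ h = ∀ᶠ 2 (∀ᶠ 3 (parallelWalkᶠ h ⇒ᶠ (Lₐ 2 ⇔ᶠ Lₐ 3)))

-- k * 94 rather than 94 * k, so that the recursive step holds by computation.
size-parallelWalkᶠ : ∀ k → size (parallelWalkᶠ k) ≡ 21 + k * 94
size-parallelWalkᶠ zero    = refl
size-parallelWalkᶠ (suc k) = cong (94 +_) (size-parallelWalkᶠ k)

size-isoᶠ : ∀ h → size (isoᶠ h) ≡ 48 + h * 94
size-isoᶠ h = begin
  size (isoᶠ h)              ≡⟨ cong (λ s → 8 + (s + 19)) (size-parallelWalkᶠ h) ⟩
  8 + (21 + h * 94 + 19)     ≡⟨ cong (29 +_) (+-comm (h * 94) 19) ⟩
  48 + h * 94                ∎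
  where open ≡-Reasoning

occursFree : ℕ → Fm → Bool
occursFree z (x ≐ y)  = (z ≡ᵇ x) ∨ (z ≡ᵇ y)
occursFree z (Eₐ x y) = (z ≡ᵇ x) ∨ (z ≡ᵇ y)
occursFree z (Lₐ x)   = z ≡ᵇ x
occursFree z (¬ᶠ φ)   = occursFree z φ
occursFree z (φ ∧ᶠ ψ) = occursFree z φ ∨ occursFree z ψ
occursFree z (φ ∨ᶠ ψ) = occursFree z φ ∨ occursFree z ψ
occursFree z (∃ᶠ x φ) = not (z ≡ᵇ x) ∧ occursFree z φ
occursFree z (∀ᶠ x φ) = not (z ≡ᵇ x) ∧ occursFree z φ

Free⇒occursFree : ∀ {z φ} → Free z φ → T (occursFree z φ)
Free⇒occursFree {z} eqˡ = from T-∨ (inj₁ (≡⇒≡ᵇ z z refl))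
Free⇒occursFree {z} eqʳ = from T-∨ (inj₂ (≡⇒≡ᵇ z z refl))
Free⇒occursFree {z} Eˡ  = from T-∨ (inj₁ (≡⇒≡ᵇ z z refl))
Free⇒occursFree {z} Eʳ  = from T-∨ (inj₂ (≡⇒≡ᵇ z z refl))
Free⇒occursFree {z} L₀  = ≡⇒≡ᵇ z z refl
Free⇒occursFree (neg p) = Free⇒occursFree p
Free⇒occursFree (∧ˡ p)  = from T-∨ (inj₁ (Free⇒occursFree p))
Free⇒occursFree (∧ʳ p)  = from T-∨ (inj₂ (Free⇒occursFree p))
Free⇒occursFree (∨ˡ p)  = from T-∨ (inj₁ (Free⇒occursFree p))
Free⇒occursFree (∨ʳ p)  = from T-∨ (inj₂ (Free⇒occursFree p))
Free⇒occursFree (ex z≢x p) = from T-∧ (from T-not (z≢x ∘ ≡ᵇ⇒≡ _ _) , Free⇒occursFree p)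
Free⇒occursFree (fa z≢x p) = from T-∧ (from T-not (z≢x ∘ ≡ᵇ⇒≡ _ _) , Free⇒occursFree p)

-- For m ≥ 6 every comparison of 4 + m with a variable of the formula computes to false, and
-- what remains of occursFree is the same question for parallelWalkᶠ k.
¬occursFree-parallelWalkᶠ : ∀ k m → occursFree (4 + m) (parallelWalkᶠ k) ≡ false
¬occursFree-parallelWalkᶠ zero    m = refl
¬occursFree-parallelWalkᶠ (suc k) 0 = refl
¬occursFree-parallelWalkᶠ (suc k) 1 = refl
¬occursFree-parallelWalkᶠ (suc k) 2 = refl
¬occursFree-parallelWalkᶠ (suc k) 3 = refl
¬occursFree-parallelWalkᶠ (suc k) 4 = refl
¬occursFree-parallelWalkᶠ (suc k) 5 = refl
¬occursFree-parallelWalkᶠ (suc k) (suc (suc (suc (suc (suc (suc m)))))) = ¬occursFree-parallelWalkᶠ k (6 + m)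

isoᶠ-freeIn01 : ∀ h → FreeIn01 (isoᶠ h)
isoᶠ-freeIn01 h z z-free = free-0-or-1 z (Free⇒occursFree z-free)
  where
  free-0-or-1 : ∀ z → T (occursFree z (isoᶠ h)) → z ≡ 0 ⊎ z ≡ 1
  free-0-or-1 0 _ = inj₁ refl
  free-0-or-1 1 _ = inj₂ refl
  free-0-or-1 (suc (suc (suc (suc m)))) occ =
    ⊥-elim (subst (λ b → T (b ∨ false)) (¬occursFree-parallelWalkᶠ h m) occ)

module Tarski (𝔄 : Str) where

  Env : Set
  Env = ℕ → Fin (n 𝔄)

  ⟦_⟧ : Fm → Env → Set
  ⟦ x ≐ y ⟧  ρ = ρ x ≡ ρ y
  ⟦ Eₐ x y ⟧ ρ = E 𝔄 (ρ x) (ρ y) ≡ true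
  ⟦ Lₐ x ⟧   ρ = L 𝔄 (ρ x) ≡ true
  ⟦ ¬ᶠ φ ⟧   ρ = ¬ ⟦ φ ⟧ ρ
  ⟦ φ ∧ᶠ ψ ⟧ ρ = ⟦ φ ⟧ ρ × ⟦ ψ ⟧ ρ
  ⟦ φ ∨ᶠ ψ ⟧ ρ = ⟦ φ ⟧ ρ ⊎ ⟦ ψ ⟧ ρ
  ⟦ ∃ᶠ x φ ⟧ ρ = ∃ λ a → ⟦ φ ⟧ (ρ [ x ↦ a ])
  ⟦ ∀ᶠ x φ ⟧ ρ = ∀ a → ⟦ φ ⟧ (ρ [ x ↦ a ])

  eval⇔⟦⟧ : ∀ φ ρ → T (eval 𝔄 φ ρ) ⇔ ⟦ φ ⟧ ρ
  eval⇔⟦⟧ (x ≐ y)  ρ = T-==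
  eval⇔⟦⟧ (Eₐ x y) ρ = T-≡
  eval⇔⟦⟧ (Lₐ x)   ρ = T-≡
  eval⇔⟦⟧ (¬ᶠ φ)   ρ = ⇔-trans T-not (¬-cong-⇔ (eval⇔⟦⟧ φ ρ))
  eval⇔⟦⟧ (φ ∧ᶠ ψ) ρ = ⇔-trans T-∧ (eval⇔⟦⟧ φ ρ ×-⇔ eval⇔⟦⟧ ψ ρ)
  eval⇔⟦⟧ (φ ∨ᶠ ψ) ρ = ⇔-trans T-∨ (eval⇔⟦⟧ φ ρ ⊎-⇔ eval⇔⟦⟧ ψ ρ)
  eval⇔⟦⟧ (∃ᶠ x φ) ρ = mk⇔
    (λ t → let (a , ta) = to (T-any-allFin _) t in a , to (eval⇔⟦⟧ φ _) ta)
    (λ (a , s) → from (T-any-allFin _) (a , from (eval⇔⟦⟧ φ _) s))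
  eval⇔⟦⟧ (∀ᶠ x φ) ρ = mk⇔
    (λ t a → to (eval⇔⟦⟧ φ _) (to (T-all-allFin _) t a))
    (λ s → from (T-all-allFin _) λ a → from (eval⇔⟦⟧ φ _) (s a))

  ⊨⇔⟦⟧ : ∀ φ a b → 𝔄 ⊨ φ [ a , b ] ⇔ ⟦ φ ⟧ (λ z → if z ≡ᵇ 0 then a else b)
  ⊨⇔⟦⟧ φ a b = ⇔-trans (⇔-sym T-≡) (eval⇔⟦⟧ φ _)

  ⟦_⟧? : ∀ φ ρ → Dec (⟦ φ ⟧ ρ)
  ⟦ φ ⟧? ρ = Dec-map (eval⇔⟦⟧ φ ρ) (T? _)

  ⟦⇔ᶠ⟧ : ∀ φ ψ ρ → ⟦ φ ⇔ᶠ ψ ⟧ ρ ⇔ (⟦ φ ⟧ ρ ⇔ ⟦ ψ ⟧ ρ)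
  ⟦⇔ᶠ⟧ φ ψ ρ = mk⇔ (λ (f , g) → mk⇔ (modus-ponens f) (modus-ponens g))
                  (λ p⇔q → ¬⊎-intro (⟦ φ ⟧? ρ) (to p⇔q) , ¬⊎-intro (⟦ ψ ⟧? ρ) (from p⇔q))

  _[_↦⁴_] : Env → Vars⁴ → Fin (n 𝔄) × Fin (n 𝔄) × Fin (n 𝔄) × Fin (n 𝔄) → Env
  ρ [ (a , b , c , d) ↦⁴ (p , q , r , s) ] = ρ [ a ↦ p ] [ b ↦ q ] [ c ↦ r ] [ d ↦ s ]

  ⟦[x⃗≔y⃗]⟧ : ∀ φ ρ → ⟦ φ [x⃗≔y⃗] ⟧ ρ ⇔ ⟦ φ ⟧ (ρ [ x⃗ ↦⁴ (ρ 6 , ρ 7 , ρ 8 , ρ 9) ])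
  ⟦[x⃗≔y⃗]⟧ φ ρ = mk⇔
    (λ s → modus-ponens (s (ρ 6) (ρ 7) (ρ 8) (ρ 9)) (refl , refl , refl , refl))
    (λ t p₀ p₁ p₂ p₃ → ¬⊎-intro (⟦ x⃗ ≐⁴ y⃗ ⟧? (ρ [ x⃗ ↦⁴ (p₀ , p₁ , p₂ , p₃) ]))
                                λ { (refl , refl , refl , refl) → t })

  ⟦∀halves⟧ : ∀ φ ρ → ⟦ ∀⁴ y⃗ (halvesᶠ ⇒ᶠ φ) ⟧ ρ ⇔
                      (⟦ φ ⟧ (ρ [ y⃗ ↦⁴ (ρ 0 , ρ 1 , ρ 4 , ρ 5) ]) × ⟦ φ ⟧ (ρ [ y⃗ ↦⁴ (ρ 4 , ρ 5 , ρ 2 , ρ 3) ]))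
  ⟦∀halves⟧ φ ρ = mk⇔
    (λ s → modus-ponens (s (ρ 0) (ρ 1) (ρ 4) (ρ 5)) (inj₁ (refl , refl , refl , refl)) ,
           modus-ponens (s (ρ 4) (ρ 5) (ρ 2) (ρ 3)) (inj₂ (refl , refl , refl , refl)))
    (λ (first , second) u u′ v v′ → ¬⊎-intro (⟦ halvesᶠ ⟧? (ρ [ y⃗ ↦⁴ (u , u′ , v , v′) ]))
      λ { (inj₁ (refl , refl , refl , refl)) → first
        ; (inj₂ (refl , refl , refl , refl)) → second })

module Walks (𝔄 : Str) where

  V : Set
  V = Fin (n 𝔄)

  infixl 5 _▸_
  data Walk : ℕ → V → V → Set where
    []  : ∀ {x} → Walk 0 x x
    _▸_ : ∀ {ℓ x y z} → Walk ℓ x y → E 𝔄 y z ≡ true → Walk (suc ℓ) x z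

  _++ʷ_ : ∀ {ℓ m x y z} → Walk m x y → Walk ℓ y z → Walk (ℓ + m) x z
  w ++ʷ []      = w
  w ++ʷ (v ▸ e) = (w ++ʷ v) ▸ e

  splitWalk : ∀ ℓ {m x z} → Walk (ℓ + m) x z → ∃ λ y → Walk m x y × Walk ℓ y z
  splitWalk zero    w       = _ , w , []
  splitWalk (suc ℓ) (w ▸ e) = let (y , u , v) = splitWalk ℓ w in y , u , v ▸ e

  ParallelWalk : ℕ → V → V → V → V → Set
  ParallelWalk H x y u v = ∃ λ ℓ → ℓ ≤ H × Walk ℓ x u × Walk ℓ y v

  LabelsAgree : ℕ → V → V → Set
  LabelsAgree H a b = ∀ u v → ParallelWalk H a b u v → L 𝔄 u ≡ L 𝔄 v

  parallelWalk-1 : ∀ {x y u v} →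
    ParallelWalk 1 x y u v ⇔ ((x ≡ u × y ≡ v) ⊎ (E 𝔄 x u ≡ true × E 𝔄 y v ≡ true))
  parallelWalk-1 = mk⇔ to′ from′
    where
    to′ : ∀ {x y u v} → ParallelWalk 1 x y u v → (x ≡ u × y ≡ v) ⊎ (E 𝔄 x u ≡ true × E 𝔄 y v ≡ true)
    to′ (0 , _ , [] , [])          = inj₁ (refl , refl)
    to′ (1 , _ , [] ▸ e , [] ▸ e′) = inj₂ (e , e′)
    to′ (suc (suc _) , s≤s () , _)
    from′ : ∀ {x y u v} → (x ≡ u × y ≡ v) ⊎ (E 𝔄 x u ≡ true × E 𝔄 y v ≡ true) → ParallelWalk 1 x y u v
    from′ (inj₁ (refl , refl)) = 0 , z≤n , [] , []
    from′ (inj₂ (e , e′))      = 1 , ≤-refl , [] ▸ e , [] ▸ e′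

  parallelWalk-double : ∀ {H x y u v} →
    ParallelWalk (2 * H) x y u v ⇔ ∃₂ λ z z′ → ParallelWalk H x y z z′ × ParallelWalk H z z′ u v
  parallelWalk-double {H} = mk⇔ split join
    where
    split : ∀ {x y u v} → ParallelWalk (2 * H) x y u v →
            ∃₂ λ z z′ → ParallelWalk H x y z z′ × ParallelWalk H z z′ u v
    split (ℓ , ℓ≤2H , w , w′) with split-≤-double {H} ℓ≤2H
    ... | ℓ₁ , ℓ₂ , refl , ℓ₁≤H , ℓ₂≤H with splitWalk ℓ₂ w | splitWalk ℓ₂ w′
    ... | z , w₁ , w₂ | z′ , w₁′ , w₂′ = z , z′ , (ℓ₁ , ℓ₁≤H , w₁ , w₁′) , (ℓ₂ , ℓ₂≤H , w₂ , w₂′)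
    join : ∀ {x y u v} → (∃₂ λ z z′ → ParallelWalk H x y z z′ × ParallelWalk H z z′ u v) →
           ParallelWalk (2 * H) x y u v
    join (_ , _ , (ℓ₁ , ℓ₁≤H , w₁ , w₁′) , (ℓ₂ , ℓ₂≤H , w₂ , w₂′)) =
      ℓ₂ + ℓ₁ , +-mono-≤ ℓ₂≤H (≤-trans ℓ₁≤H (m≤m+n H 0)) , w₁ ++ʷ w₂ , w₁′ ++ʷ w₂′

module WalkFormulas (𝔄 : Str) where
  open Tarski 𝔄
  open Walks 𝔄

  ⟦parallelWalkᶠ⟧ : ∀ k ρ → ⟦ parallelWalkᶠ k ⟧ ρ ⇔ ParallelWalk (2 ^ k) (ρ 0) (ρ 1) (ρ 2) (ρ 3)
  ⟦parallelWalkᶠ⟧ zero    ρ = ⇔-sym parallelWalk-1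
  ⟦parallelWalkᶠ⟧ (suc k) ρ =
    ⇔-trans (∃₂-cong-⇔ halves) (⇔-sym parallelWalk-double)
    where
    renamed : ∀ ρ → ⟦ parallelWalkᶠ k [x⃗≔y⃗] ⟧ ρ ⇔ ParallelWalk (2 ^ k) (ρ 6) (ρ 7) (ρ 8) (ρ 9)
    renamed ρ = ⇔-trans (⟦[x⃗≔y⃗]⟧ (parallelWalkᶠ k) ρ)
                        (⟦parallelWalkᶠ⟧ k (ρ [ x⃗ ↦⁴ (ρ 6 , ρ 7 , ρ 8 , ρ 9) ]))
    halves : ∀ z z′ → ⟦ ∀⁴ y⃗ (halvesᶠ ⇒ᶠ parallelWalkᶠ k [x⃗≔y⃗]) ⟧ (ρ [ 4 ↦ z ] [ 5 ↦ z′ ]) ⇔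
                      (ParallelWalk (2 ^ k) (ρ 0) (ρ 1) z z′ × ParallelWalk (2 ^ k) z z′ (ρ 2) (ρ 3))
    halves z z′ = ⇔-trans (⟦∀halves⟧ (parallelWalkᶠ k [x⃗≔y⃗]) ρ′)
                          (renamed (ρ′ [ y⃗ ↦⁴ (ρ 0 , ρ 1 , z , z′) ]) ×-⇔ renamed (ρ′ [ y⃗ ↦⁴ (z , z′ , ρ 2 , ρ 3) ]))
      where
      ρ′ : Env
      ρ′ = ρ [ 4 ↦ z ] [ 5 ↦ z′ ]

  ⟦isoᶠ⟧ : ∀ h ρ → ⟦ isoᶠ h ⟧ ρ ⇔ LabelsAgree (2 ^ h) (ρ 0) (ρ 1)
  ⟦isoᶠ⟧ h ρ = mk⇔
    (λ s u v p → ⇔→≡ (to (⟦⇔ᶠ⟧ (Lₐ 2) (Lₐ 3) (ρ′ u v))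
                        (modus-ponens (s u v) (from (⟦parallelWalkᶠ⟧ h (ρ′ u v)) p))))
    (λ agree u v → ¬⊎-intro (⟦ parallelWalkᶠ h ⟧? (ρ′ u v)) λ s →
      from (⟦⇔ᶠ⟧ (Lₐ 2) (Lₐ 3) (ρ′ u v)) (≡⇒⇔ (agree u v (to (⟦parallelWalkᶠ⟧ h (ρ′ u v)) s))))
    where
    ρ′ : Fin (n 𝔄) → Fin (n 𝔄) → Env
    ρ′ u v = ρ [ 2 ↦ u ] [ 3 ↦ v ]
    ≡⇒⇔ : ∀ {x y : Bool} → x ≡ y → (x ≡ true) ⇔ (y ≡ true)
    ≡⇒⇔ refl = ⇔-id _

module Chains (𝔄 : Str) where
  open Walks 𝔄

  walk-conn : ∀ {a x y ℓ} → Conn 𝔄 a x → Walk ℓ x y → Conn 𝔄 a y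
  walk-conn c []      = c
  walk-conn c (w ▸ e) = fwd (walk-conn c w) e

  chain-succ-unique : ∀ {H b w v v′} → CompIsChain 𝔄 H b →
                      Conn 𝔄 b w → E 𝔄 w v ≡ true → E 𝔄 w v′ ≡ true → v ≡ v′
  chain-succ-unique (f , _ , _ , f-onto , f-edge) cw e e′
    with f-onto _ cw | f-onto _ (fwd cw e) | f-onto _ (fwd cw e′)
  ... | i , refl | j , refl | j′ , refl =
    cong f (toℕ-injective (trans (to (f-edge i j) e) (sym (to (f-edge i j′) e′))))

  chain-walk-unique : ∀ {H b x v v′ ℓ} → CompIsChain 𝔄 H b →
                      Conn 𝔄 b x → Walk ℓ x v → Walk ℓ x v′ → v ≡ v′
  chain-walk-unique ch cx []      []        = refl
  chain-walk-unique ch cx (w ▸ e) (w′ ▸ e′) with chain-walk-unique ch cx w w′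
  ... | refl = chain-succ-unique ch (walk-conn cx w) e e′

  chain-root : ∀ {H b r} (ch : CompIsChain 𝔄 H b) → IsRoot 𝔄 r → Conn 𝔄 b r → r ≡ proj₁ ch zero
  chain-root (f , _ , _ , f-onto , f-edge) r-root cr with f-onto _ cr
  ... | zero  , refl = refl
  ... | suc i , refl
    with () ← trans (sym (from (f-edge (inject₁ i) (suc i)) (cong suc (sym (toℕ-inject₁ i))))) (r-root _)

  chain-walk : ∀ {H b} (ch : CompIsChain 𝔄 H b) → ∀ i → Walk (toℕ i) (proj₁ ch zero) (proj₁ ch i)
  chain-walk {H} (f , _ , _ , _ , f-edge) i =
    subst (Walk (toℕ i) (f zero) ∘ f) (fromℕ<-toℕ i (toℕ<n i)) (walk-from-head (toℕ i) (toℕ<n i))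
    where
    -- by induction on the height ℓ: the predecessor of suc i : Fin (suc H) is inject₁ i, not i
    walk-from-head : ∀ ℓ (ℓ<1+H : ℓ < suc H) → Walk ℓ (f zero) (f (fromℕ< ℓ<1+H))
    walk-from-head zero    _      = []
    walk-from-head (suc ℓ) ℓ<1+H  = walk-from-head ℓ ℓ<H ▸
      from (f-edge _ _) (trans (toℕ-fromℕ< ℓ<1+H) (cong suc (sym (toℕ-fromℕ< ℓ<H))))
      where
      ℓ<H : ℓ < suc H
      ℓ<H = <-trans (n<1+n ℓ) ℓ<1+H

  reindex : ∀ {H a b} → CompIsChain 𝔄 H a → CompIsChain 𝔄 H b → Comp 𝔄 a → Comp 𝔄 b
  reindex (_ , _ , _ , f-onto , _) (g , _ , g-conn , _ , _) (u , cu) = g (proj₁ (f-onto u cu)) , g-conn _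

  reindex-inverse : ∀ {H a b} (cha : CompIsChain 𝔄 H a) (chb : CompIsChain 𝔄 H b) u →
                    proj₁ (reindex chb cha (reindex cha chb u)) ≡ proj₁ u
  reindex-inverse (f , _ , _ , f-onto , _) (g , g-inj , g-conn , g-onto , _) (u , cu) with f-onto u cu
  ... | i , refl = cong f (g-inj _ _ (proj₂ (g-onto (g i) (g-conn i))))

  reindex-E : ∀ {H a b} (cha : CompIsChain 𝔄 H a) (chb : CompIsChain 𝔄 H b) u v →
              E 𝔄 (proj₁ u) (proj₁ v) ≡ E 𝔄 (proj₁ (reindex cha chb u)) (proj₁ (reindex cha chb v))
  reindex-E (f , _ , _ , f-onto , f-edge) (g , _ , _ , _ , g-edge) (u , cu) (v , cv)
    with f-onto u cu | f-onto v cv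
  ... | i , refl | j , refl = ⇔→≡ (⇔-trans (f-edge i j) (⇔-sym (g-edge i j)))

  reindex-L : ∀ {H a b} (cha : CompIsChain 𝔄 H a) (chb : CompIsChain 𝔄 H b) →
              (∀ i → L 𝔄 (proj₁ cha i) ≡ L 𝔄 (proj₁ chb i)) →
              ∀ u → L 𝔄 (proj₁ u) ≡ L 𝔄 (proj₁ (reindex cha chb u))
  reindex-L (f , _ , _ , f-onto , _) chb same-labels (u , cu) with f-onto u cu
  ... | i , refl = same-labels i

  chains-iso : ∀ {H a b} (cha : CompIsChain 𝔄 H a) (chb : CompIsChain 𝔄 H b) →
               (∀ i → L 𝔄 (proj₁ cha i) ≡ L 𝔄 (proj₁ chb i)) → CompIso 𝔄 a b
  chains-iso cha chb same-labels =
    reindex cha chb , reindex chb cha , reindex-inverse cha chb , reindex-inverse chb cha ,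
    reindex-E cha chb , reindex-L cha chb same-labels

  iso-root : ∀ {a b} ((F , _) : CompIso 𝔄 a b) → IsRoot 𝔄 a → IsRoot 𝔄 (proj₁ (F (a , here)))
  iso-root {a} (F , G , GF , FG , F-E , _) a-root w with E 𝔄 w (proj₁ (F (a , here))) in w→Fa
  ... | false = refl
  ... | true  = contradiction (trans (sym Gw→a) (a-root _)) λ ()
    where
    open ≡-Reasoning
    Fa = F (a , here)
    Gw = G (w , bwd (proj₂ Fa) w→Fa)
    Gw→a : E 𝔄 (proj₁ Gw) a ≡ true
    Gw→a = begin
      E 𝔄 (proj₁ Gw) a                            ≡⟨ cong (E 𝔄 _) (GF (a , here)) ⟨
      E 𝔄 (proj₁ Gw) (proj₁ (G Fa))               ≡⟨ F-E Gw (G Fa) ⟩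
      E 𝔄 (proj₁ (F Gw)) (proj₁ (F (G Fa)))       ≡⟨ cong₂ (E 𝔄) (FG _) (FG Fa) ⟩
      E 𝔄 w (proj₁ Fa)                            ≡⟨ w→Fa ⟩
      true                                        ∎

  iso-walk : ∀ {a b x y ℓ} ((F , _) : CompIso 𝔄 a b) (cx : Conn 𝔄 a x) → Walk ℓ x y →
             Σ (Conn 𝔄 a y) λ cy → Walk ℓ (proj₁ (F (x , cx))) (proj₁ (F (y , cy)))
  iso-walk iso                           cx []      = cx , []
  iso-walk iso@(F , _ , _ , _ , F-E , _) cx (w ▸ e) =
    let (cz , Fw) = iso-walk iso cx w in fwd cz e , Fw ▸ trans (sym (F-E (_ , cz) (_ , fwd cz e))) e

  iso⇒labelsAgree : ∀ {H a b} → CompIsChain 𝔄 H b → IsRoot 𝔄 a → IsRoot 𝔄 b →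
                    CompIso 𝔄 a b → LabelsAgree H a b
  iso⇒labelsAgree {a = a} {b} chb a-root b-root iso@(F , _ , _ , _ , _ , F-L) u v (ℓ , _ , a⇝u , b⇝v) =
    trans (F-L (u , cu)) (cong (L 𝔄) (sym v≡Fu))
    where
    Fa≡b : proj₁ (F (a , here)) ≡ b
    Fa≡b = trans (chain-root chb (iso-root iso a-root) (proj₂ (F (a , here))))
                 (sym (chain-root chb b-root here))
    cu = proj₁ (iso-walk iso here a⇝u)
    Fa⇝Fu = proj₂ (iso-walk iso here a⇝u)
    v≡Fu : v ≡ proj₁ (F (u , cu))
    v≡Fu = chain-walk-unique chb here b⇝v (subst (λ x → Walk ℓ x (proj₁ (F (u , cu)))) Fa≡b Fa⇝Fu)

  labelsAgree⇒iso : ∀ {H a b} → CompIsChain 𝔄 H a → CompIsChain 𝔄 H b → IsRoot 𝔄 a → IsRoot 𝔄 b →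
                    LabelsAgree H a b → CompIso 𝔄 a b
  labelsAgree⇒iso cha chb a-root b-root agree = chains-iso cha chb λ i →
    agree _ _ (toℕ i , toℕ≤pred[n] i , walk-from-root cha a-root i , walk-from-root chb b-root i)
    where
    walk-from-root : ∀ {H r} (ch : CompIsChain 𝔄 H r) → IsRoot 𝔄 r → ∀ i → Walk (toℕ i) r (proj₁ ch i)
    walk-from-root ch r-root i = subst (λ x → Walk (toℕ i) x _) (sym (chain-root ch r-root here)) (chain-walk ch i)

  labelsAgree⇔iso : ∀ {H a b} → CompIsChain 𝔄 H a → CompIsChain 𝔄 H b → IsRoot 𝔄 a → IsRoot 𝔄 b →
                    LabelsAgree H a b ⇔ CompIso 𝔄 a b
  labelsAgree⇔iso cha chb a-root b-root =
    mk⇔ (labelsAgree⇒iso cha chb a-root b-root) (iso⇒labelsAgree chb a-root b-root)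

lemma13 : Σ ℕ λ c → 1 ≤ c × Σ (ℕ → Fm) λ iso →
    (∀ h → 1 ≤ h → size (iso h) ≤ c * h × FreeIn01 (iso h)) ×
    (∀ h → 1 ≤ h → (𝔉 : Str) → In𝔉₂ (2 ^ h) 𝔉 →
    (a b : Fin (Str.n 𝔉)) → IsRoot 𝔉 a → IsRoot 𝔉 b →
    (𝔉 ⊨ iso h [ a , b ] ⇔ CompIso 𝔉 a b))
lemma13 = 142 , s≤s z≤n , isoᶠ , size-and-free , defines-iso
  where
  size-and-free : ∀ h → 1 ≤ h → size (isoᶠ h) ≤ 142 * h × FreeIn01 (isoᶠ h)
  size-and-free h@(suc _) _ = ≤-trans (≤-reflexive (size-isoᶠ h)) (affine≤linear 48 94 h) , isoᶠ-freeIn01 h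
  defines-iso : ∀ h → 1 ≤ h → (𝔉 : Str) → In𝔉₂ (2 ^ h) 𝔉 → (a b : Fin (Str.n 𝔉)) →
                IsRoot 𝔉 a → IsRoot 𝔉 b → 𝔉 ⊨ isoᶠ h [ a , b ] ⇔ CompIso 𝔉 a b
  defines-iso h _ 𝔉 chains a b a-root b-root =
    ⇔-trans (Tarski.⊨⇔⟦⟧ 𝔉 (isoᶠ h) a b)
    (⇔-trans (WalkFormulas.⟦isoᶠ⟧ 𝔉 h _)
             (labelsAgree⇔iso (chains a) (chains b) a-root b-root))
    where open Chains 𝔉
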